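{- Let $a_1,\dots,a_{15}$ be fifteen vertices and let $G^4_0$ be the graph on these vertices with the $30$ edges $a_{15}a_4, a_{15}a_{11}, a_{15}a_{12}, a_{15}a_3, a_{14}a_2, a_{14}a_{10}, a_{14}a_{13}, a_{14}a_5, a_{13}a_6, a_{13}a_8, a_{13}a_5, a_{12}a_3, a_{12}a_9, a_{12}a_7, a_{11}a_4, a_{11}a_8, a_{11}a_9, a_{10}a_2, a_{10}a_7, a_{10}a_6, a_9a_8, a_9a_7, a_8a_6, a_7a_6, a_5a_1, a_5a_4, a_4a_1, a_3a_1, a_3a_2, a_2a_1$. Put $v_0^0:=a_{14}$, $v_1^0:=a_2$, $v_2^0:=a_{10}$ (these form a triangle). For $i>0$, given $G^4_{i-1}$ containing the triangle $v_0^{i-1}v_1^{i-1}v_2^{i-1}$, let $G^4_i$ be the graph with vertex set $V(G^4_{i-1})\cup\{v_0^i,v_1^i,v_2^i\}$ (three new vertices) and edge set $$\bigl(E(G^4_{i-1})\setminus\{v_0^{i-1}v_1^{i-1},v_1^{i-1}v_2^{i-1},v_2^{i-1}v_0^{i-1}\}\bigr)\cup\{v_0^iv_1^i,v_1^iv_2^i,v_2^iv_0^i\}\cup\{v_0^iv_1^{i-1},v_0^iv_2^{i-1},v_1^iv_0^{i-1},v_1^iv_2^{i-1},v_2^iv_0^{i-1},v_2^iv_1^{i-1}\}.$$ Let $\mathcal{G}:=\{G^4_i\mid i\ge 0\}$. Then for every graph $G\in\mathcal{G}$, $\chi_i(G)=8$.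
   Context: All graphs are simple and undirected. For $k>0$, an injective $k$-colouring of a graph $G$ is a map $c:V(G)\to\{1,\dots,k\}$ such that any two distinct vertices having a common neighbour receive different colours. The injective chromatic number $\chi_i(G)$ is the smallest $k$ for which $G$ has an injective $k$-colouring. -}

module Defs where

open import Data.Nat using (ℕ; zero; suc; _+_; _*_; _∸_; _≡ᵇ_; _≤_)
open import Data.Bool using (Bool; true; false; _∧_; _∨_; not; T)
open import Data.List using (List; []; _∷_)
open import Data.Bool.ListAction using (any)
open import Data.Product using (_×_; _,_; ∃)
open import Data.Fin using (Fin; toℕ)
open import Relation.Binary.PropositionalEquality using (_≡_; _≢_)

record Graph : Set₁ where
  field
    n   : ℕ
    Adj : Fin n → Fin n → Set

open Graph public

IsInjectiveColouring : (G : Graph) (k : ℕ) → (Fin (n G) → Fin k) → Set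
IsInjectiveColouring G k c =
  ∀ (x y z : Fin (n G)) → x ≢ y → Adj G z x → Adj G z y → c x ≢ c y

HasInjectiveColouring : Graph → ℕ → Set
HasInjectiveColouring G k = ∃ λ (c : Fin (n G) → Fin k) → IsInjectiveColouring G k c

InjChromaticNumber : Graph → ℕ → Set
InjChromaticNumber G m =
  HasInjectiveColouring G m × (∀ k → HasInjectiveColouring G k → m ≤ k)

-- The family G^4_i.  Vertex a_j (1 ≤ j ≤ 15) is the natural number j ∸ 1;
-- the three vertices added at stage i ≥ 1 are 15 + 3(i-1) + {0,1,2}.

a : ℕ → ℕ
a j = j ∸ 1

edgeIn : List (ℕ × ℕ) → ℕ → ℕ → Bool
edgeIn es u v = any (λ { (x , y) → ((x ≡ᵇ u) ∧ (y ≡ᵇ v)) ∨ ((x ≡ᵇ v) ∧ (y ≡ᵇ u)) }) es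

baseEdges : List (ℕ × ℕ)
baseEdges =
  (a 15 , a 4) ∷ (a 15 , a 11) ∷ (a 15 , a 12) ∷ (a 15 , a 3) ∷
  (a 14 , a 2) ∷ (a 14 , a 10) ∷ (a 14 , a 13) ∷ (a 14 , a 5) ∷
  (a 13 , a 6) ∷ (a 13 , a 8) ∷ (a 13 , a 5) ∷ (a 12 , a 3) ∷
  (a 12 , a 9) ∷ (a 12 , a 7) ∷ (a 11 , a 4) ∷ (a 11 , a 8) ∷
  (a 11 , a 9) ∷ (a 10 , a 2) ∷ (a 10 , a 7) ∷ (a 10 , a 6) ∷
  (a 9 , a 8) ∷ (a 9 , a 7) ∷ (a 8 , a 6) ∷ (a 7 , a 6) ∷
  (a 5 , a 1) ∷ (a 5 , a 4) ∷ (a 4 , a 1) ∷ (a 3 , a 1) ∷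
  (a 3 , a 2) ∷ (a 2 , a 1) ∷ []

-- tri i j = v_j^i  (j ∈ {0,1,2})
tri : ℕ → ℕ → ℕ
tri zero zero = a 14
tri zero (suc zero) = a 2
tri zero (suc (suc _)) = a 10
tri (suc i) j = 15 + 3 * i + j

triEdges : ℕ → List (ℕ × ℕ)
triEdges i = (tri i 0 , tri i 1) ∷ (tri i 1 , tri i 2) ∷ (tri i 2 , tri i 0) ∷ []

crossEdges : ℕ → List (ℕ × ℕ)
crossEdges i =
  (tri (suc i) 0 , tri i 1) ∷ (tri (suc i) 0 , tri i 2) ∷
  (tri (suc i) 1 , tri i 0) ∷ (tri (suc i) 1 , tri i 2) ∷
  (tri (suc i) 2 , tri i 0) ∷ (tri (suc i) 2 , tri i 1) ∷ []

edge : ℕ → ℕ → ℕ → Bool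
edge zero u v = edgeIn baseEdges u v
edge (suc i) u v =
  (edge i u v ∧ not (edgeIn (triEdges i) u v))
  ∨ edgeIn (triEdges (suc i)) u v
  ∨ edgeIn (crossEdges i) u v

G4 : ℕ → Graph
G4 i = record
  { n   = 15 + 3 * i
  ; Adj = λ x y → T (edge i (toℕ x) (toℕ y))
  }

{-# OPTIONS --safe #-}
-- Upper bound: colour the fifteen base vertices by a fixed injective 8-colouring that gives
-- the initial triangle (a₁₄, a₂, a₁₀) the colours 0, 1, 2, and each later triangle by one of
-- the palettes {0, 1, 2} and {3, 4, 5}.  In G⁴ᵢ a corner of triangle j has its neighbours in
-- triangles j − 1 and j + 1, or, on the top triangle i, in triangles i − 1 and i; so it is
-- enough that triangles two apart, and the top two triangles, use different palettes.  The
-- pattern AABB shifted by the parity of i does this; a finite check keeps the base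
-- neighbours of the initial triangle off the colours of triangle 1.
--
-- Lower bound: call two base vertices in conflict if both lie on the initial triangle or
-- they have a common base neighbour through edges that are never deleted; they then have a
-- common neighbour in every G⁴ᵢ.  Any three base vertices contain a conflicting pair, so an
-- injective k-colouring uses each colour at most twice on the base, and 15 ≤ 2k.
module Submission where

open import Defs
open import Data.Bool using (true; false; T; not; _∧_; _∨_)
open import Data.Bool.Properties using (T-∧; T-∨)
open import Data.Empty using (⊥-elim)
open import Data.Fin as Fin using (Fin; zero; suc; toℕ; fromℕ<; combine; _↑ˡ_; #_)
open import Data.Fin.Properties as FinP
  using ( toℕ<n; toℕ-fromℕ<; toℕ-injective; toℕ-↑ˡ; ↑ˡ-injective
        ; combine-injectiveˡ; combine-injectiveʳ; injective⇒≤ )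
open import Data.List.Membership.Propositional using (_∈_)
open import Data.List.Relation.Unary.All as All using (All)
open import Data.List.Relation.Unary.Any as Any using (here; there)
open import Data.List.Relation.Unary.Any.Properties using (any⁺; any⁻; Any-⊎⁻)
open import Data.Nat
  using (ℕ; zero; suc; _+_; _*_; _∸_; _<ᵇ_; _≡ᵇ_; _≤_; _<_; _≮_; z≤n; s≤s; z<s; _≟_; _<?_)
open import Data.Nat.Properties
  using ( ≡ᵇ⇒≡; ≡⇒≡ᵇ; <⇒<ᵇ; <ᵇ⇒<; ≤-refl; ≤-trans; m≤m+n; m<n⇒m<1+n; <⇒≱; <-irrefl
        ; +-monoʳ-≤; *-monoʳ-≤; *-suc; *-cancelʳ-<; allUpTo?; anyUpTo? )
open import Data.Product using (_×_; _,_; ∃; proj₁; proj₂; swap; uncurry; map₁)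
open import Data.Sum using (_⊎_; inj₁; inj₂; [_,_])
open import Function using (_∘_; _⇔_; mk⇔; Injective)
open import Function.Bundles using (module Equivalence)
open import Relation.Binary.Definitions using (tri<; tri≈; tri>)
open import Relation.Binary.PropositionalEquality
  using (_≡_; _≢_; refl; sym; trans; cong; cong₂; subst; subst₂; ≢-sym; module ≡-Reasoning)
open import Relation.Nullary using (¬_; Dec; yes; no)
open import Relation.Nullary.Decidable using (T?; toWitness; ¬?; _×-dec_; _⊎-dec_; _→-dec_)

open Equivalence using (to; from)

T-not⇔¬T : ∀ {b} → T (not b) ⇔ (¬ T b)
T-not⇔¬T {false} = mk⇔ (λ _ ()) (λ _ → _)
T-not⇔¬T {true}  = mk⇔ (λ ()) (λ ¬t → ¬t _)

NoMonochromaticTriple : ∀ {n k} → (Fin n → Fin k) → Set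
NoMonochromaticTriple g = ∀ {x y z} → x ≢ y → y ≢ z → x ≢ z → g x ≡ g y → g y ≢ g z

noMonochromaticTriple⇒≤ : ∀ {n k} (g : Fin n → Fin k) → NoMonochromaticTriple g → n ≤ k * 2
noMonochromaticTriple⇒≤ {n} {k} g noTriple = injective⇒≤ {f = tag} tag-injective
  where
  Repeated : Fin n → Set
  Repeated v = ∃ λ u → u Fin.< v × g u ≡ g v

  repeated? : ∀ v → Dec (Repeated v)
  repeated? v = FinP.any? λ u → (u FinP.<? v) ×-dec (g u FinP.≟ g v)

  mark : ∀ {v} → Dec (Repeated v) → Fin 2
  mark (yes _) = suc zero
  mark (no _)  = zero

  -- Tag v by its colour and by whether an earlier vertex has the same colour;
  -- a collision of tags then exhibits three vertices of one colour.
  tag : Fin n → Fin (k * 2)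
  tag v = combine (g v) (mark (repeated? v))

  earlier-repeated : ∀ {u v} → u Fin.< v → g u ≡ g v →
                     mark (repeated? u) ≡ mark (repeated? v) → Repeated u
  earlier-repeated {u} {v} u<v gu≡gv marks with repeated? u | repeated? v
  ... | yes ru | _      = ru
  ... | no _   | no ¬rv = ⊥-elim (¬rv (u , u<v , gu≡gv))

  no-collision : ∀ {u v} → u Fin.< v → tag u ≢ tag v
  no-collision {u} {v} u<v eq
    with gu≡gv ← combine-injectiveˡ (g u) _ (g v) _ eq
    with (w , w<u , gw≡gu) ← earlier-repeated u<v gu≡gv (combine-injectiveʳ (g u) _ (g v) _ eq)
    = noTriple (FinP.<⇒≢ w<u) (FinP.<⇒≢ u<v) (FinP.<⇒≢ (FinP.<-trans w<u u<v)) gw≡gu gu≡gv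

  tag-injective : Injective _≡_ _≡_ tag
  tag-injective {u} {v} eq with FinP.<-cmp u v
  ... | tri< u<v _ _ = ⊥-elim (no-collision u<v eq)
  ... | tri≈ _ u≡v _ = u≡v
  ... | tri> _ _ v<u = ⊥-elim (no-collision v<u (sym eq))

module _ {u v : ℕ} where

  private
    Matches : ℕ × ℕ → Set
    Matches (x , y) = T (((x ≡ᵇ u) ∧ (y ≡ᵇ v)) ∨ ((x ≡ᵇ v) ∧ (y ≡ᵇ u)))

  edgeIn-sound : ∀ es → T (edgeIn es u v) → (u , v) ∈ es ⊎ (v , u) ∈ es
  edgeIn-sound es t = Any-⊎⁻ (Any.map matches (any⁻ _ es t))
    where
    matches : ∀ {e} → Matches e → (u , v) ≡ e ⊎ (v , u) ≡ e
    matches {x , y} m with T-∨ .to m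
    ... | inj₁ xy = let (x≡u , y≡v) = T-∧ .to xy in
                    inj₁ (sym (cong₂ _,_ (≡ᵇ⇒≡ x u x≡u) (≡ᵇ⇒≡ y v y≡v)))
    ... | inj₂ yx = let (x≡v , y≡u) = T-∧ .to yx in
                    inj₂ (sym (cong₂ _,_ (≡ᵇ⇒≡ x v x≡v) (≡ᵇ⇒≡ y u y≡u)))

  edgeIn-complete : ∀ es → (u , v) ∈ es ⊎ (v , u) ∈ es → T (edgeIn es u v)
  edgeIn-complete es = [ any⁺ _ ∘ Any.map forward , any⁺ _ ∘ Any.map backward ]
    where
    forward : ∀ {e} → (u , v) ≡ e → Matches e
    forward refl = T-∨ .from (inj₁ (T-∧ .from (≡⇒≡ᵇ u u refl , ≡⇒≡ᵇ v v refl)))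
    backward : ∀ {e} → (v , u) ≡ e → Matches e
    backward refl = T-∨ .from (inj₂ (T-∧ .from (≡⇒≡ᵇ v v refl , ≡⇒≡ᵇ u u refl)))

baseEdges-bounded : All (λ e → proj₁ e < 15 × proj₂ e < 15) baseEdges
baseEdges-bounded =
  toWitness {a? = All.all? (λ e → (proj₁ e <? 15) ×-dec (proj₂ e <? 15)) baseEdges} _

baseEdge-bounded : ∀ u v → T (edgeIn baseEdges u v) → u < 15 × v < 15
baseEdge-bounded _ _ t with edgeIn-sound baseEdges t
... | inj₁ uv∈ = All.lookup baseEdges-bounded uv∈
... | inj₂ vu∈ = swap (All.lookup baseEdges-bounded vu∈)

triVertex : ℕ → Fin 3 → ℕ
triVertex j r = tri j (toℕ r)

triVertex≮15 : ∀ j r → triVertex (suc j) r ≮ 15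
triVertex≮15 j r lt = <⇒≱ lt (m≤m+n 15 (3 * j + toℕ r))

triVertex<15⇒j≡0 : ∀ j r → triVertex j r < 15 → j ≡ 0
triVertex<15⇒j≡0 zero    _ _  = refl
triVertex<15⇒j≡0 (suc j) r lt = ⊥-elim (triVertex≮15 j r lt)

triVertex₀<15 : ∀ r → triVertex 0 r < 15
triVertex₀<15 zero             = <ᵇ⇒< 13 15 _
triVertex₀<15 (suc zero)       = <ᵇ⇒< 1 15 _
triVertex₀<15 (suc (suc zero)) = <ᵇ⇒< 9 15 _

divMod3 : ℕ → ℕ × Fin 3
divMod3 0 = 0 , zero
divMod3 1 = 0 , suc zero
divMod3 2 = 0 , suc (suc zero)
divMod3 (suc (suc (suc m))) = map₁ suc (divMod3 m)

divMod3-correct : ∀ q r → divMod3 (3 * q + toℕ r) ≡ (q , r)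
divMod3-correct zero zero = refl
divMod3-correct zero (suc zero) = refl
divMod3-correct zero (suc (suc zero)) = refl
divMod3-correct (suc q) r = begin
  divMod3 (3 * suc q + toℕ r)        ≡⟨ cong (λ m → divMod3 (m + toℕ r)) (*-suc 3 q) ⟩
  map₁ suc (divMod3 (3 * q + toℕ r)) ≡⟨ cong (map₁ suc) (divMod3-correct q r) ⟩
  (suc q , r)                        ∎
  where open ≡-Reasoning

level : ℕ → ℕ
level u with u <ᵇ 15
... | true  = 0
... | false = suc (proj₁ (divMod3 (u ∸ 15)))

level-triVertex : ∀ j r → level (triVertex j r) ≡ j
level-triVertex zero zero = refl
level-triVertex zero (suc zero) = refl
level-triVertex zero (suc (suc zero)) = refl
level-triVertex (suc j) r = cong (suc ∘ proj₁) (divMod3-correct j r)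

triVertex-injectiveˡ : ∀ {j j' r r'} → triVertex j r ≡ triVertex j' r' → j ≡ j'
triVertex-injectiveˡ {j} {j'} {r} {r'} eq =
  trans (sym (level-triVertex j r)) (trans (cong level eq) (level-triVertex j' r'))

PersistentEdge : ℕ → ℕ → Set
PersistentEdge u v = T (edgeIn baseEdges u v) × ¬ T (edgeIn (triEdges 0) u v)

persistentEdge? : ∀ u v → Dec (PersistentEdge u v)
persistentEdge? u v = T? (edgeIn baseEdges u v) ×-dec ¬? (T? (edgeIn (triEdges 0) u v))

data Corners (j k u v : ℕ) : Set where
  corners : ∀ {r s} → r ≢ s → u ≡ triVertex j r → v ≡ triVertex k s → Corners j k u v

Corners-sym : ∀ {j k u v} → Corners j k u v → Corners k j v u
Corners-sym (corners r≢s eu ev) = corners (≢-sym r≢s) ev eu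

∈triEdges⇒Corners : ∀ {j u v} → (u , v) ∈ triEdges j → Corners j j u v
∈triEdges⇒Corners (here refl)                 = corners {r = zero}           {suc zero}       (λ ()) refl refl
∈triEdges⇒Corners (there (here refl))         = corners {r = suc zero}       {suc (suc zero)} (λ ()) refl refl
∈triEdges⇒Corners (there (there (here refl))) = corners {r = suc (suc zero)} {zero}           (λ ()) refl refl

triEdge⇒Corners : ∀ {j u v} → T (edgeIn (triEdges j) u v) → Corners j j u v
triEdge⇒Corners {j} t with edgeIn-sound (triEdges j) t
... | inj₁ uv∈ = ∈triEdges⇒Corners {j} uv∈
... | inj₂ vu∈ = Corners-sym (∈triEdges⇒Corners {j} vu∈)

Corners⇒triEdge : ∀ {j u v} → Corners j j u v → T (edgeIn (triEdges j) u v)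
Corners⇒triEdge {j} (corners {r} {s} r≢s refl refl) = edgeIn-complete (triEdges j) (listed r s r≢s)
  where
  listed : ∀ r s → r ≢ s →
           (triVertex j r , triVertex j s) ∈ triEdges j ⊎ (triVertex j s , triVertex j r) ∈ triEdges j
  listed zero             zero             r≢s = ⊥-elim (r≢s refl)
  listed zero             (suc zero)       _   = inj₁ (here refl)
  listed zero             (suc (suc zero)) _   = inj₂ (there (there (here refl)))
  listed (suc zero)       zero             _   = inj₂ (here refl)
  listed (suc zero)       (suc zero)       r≢s = ⊥-elim (r≢s refl)
  listed (suc zero)       (suc (suc zero)) _   = inj₁ (there (here refl))
  listed (suc (suc zero)) zero             _   = inj₁ (there (there (here refl)))
  listed (suc (suc zero)) (suc zero)       _   = inj₂ (there (here refl))
  listed (suc (suc zero)) (suc (suc zero)) r≢s = ⊥-elim (r≢s refl)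

∈crossEdges⇒Corners : ∀ {j u v} → (u , v) ∈ crossEdges j → Corners (suc j) j u v
∈crossEdges⇒Corners (here refl) =
  corners {r = zero} {suc zero} (λ ()) refl refl
∈crossEdges⇒Corners (there (here refl)) =
  corners {r = zero} {suc (suc zero)} (λ ()) refl refl
∈crossEdges⇒Corners (there (there (here refl))) =
  corners {r = suc zero} {zero} (λ ()) refl refl
∈crossEdges⇒Corners (there (there (there (here refl)))) =
  corners {r = suc zero} {suc (suc zero)} (λ ()) refl refl
∈crossEdges⇒Corners (there (there (there (there (here refl))))) =
  corners {r = suc (suc zero)} {zero} (λ ()) refl refl
∈crossEdges⇒Corners (there (there (there (there (there (here refl)))))) =
  corners {r = suc (suc zero)} {suc zero} (λ ()) refl refl

crossEdge⇒Corners : ∀ {j u v} → T (edgeIn (crossEdges j) u v) →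
                    Corners (suc j) j u v ⊎ Corners j (suc j) u v
crossEdge⇒Corners {j} t with edgeIn-sound (crossEdges j) t
... | inj₁ uv∈ = inj₁ (∈crossEdges⇒Corners {j} uv∈)
... | inj₂ vu∈ = inj₂ (Corners-sym (∈crossEdges⇒Corners {j} vu∈))

-- Linked i j k: G⁴ᵢ has edges between triangles j and k.
data Linked (i : ℕ) : ℕ → ℕ → Set where
  up   : ∀ {j} → j < i → Linked i j (suc j)
  down : ∀ {j} → j < i → Linked i (suc j) j
  top  : 0 < i → Linked i i i

data Edge (i z x : ℕ) : Set where
  base     : T (edgeIn baseEdges z x) → (0 < i → ¬ T (edgeIn (triEdges 0) z x)) → Edge i z x
  triangle : ∀ {j k} → Linked i j k → Corners j k z x → Edge i z x

Edge-lift : ∀ {i z x} → Edge i z x → ¬ T (edgeIn (triEdges i) z x) → Edge (suc i) z x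
Edge-lift {zero}  (base zx _)      ¬tri = base zx (λ _ → ¬tri)
Edge-lift {suc _} (base zx ¬tri₀)  _    = base zx (λ _ → ¬tri₀ z<s)
Edge-lift (triangle (up j<i) cs)   _    = triangle (up (m<n⇒m<1+n j<i)) cs
Edge-lift (triangle (down j<i) cs) _    = triangle (down (m<n⇒m<1+n j<i)) cs
Edge-lift (triangle (top _) cs)    ¬tri = ⊥-elim (¬tri (Corners⇒triEdge cs))

edge⇒Edge : ∀ i {z x} → T (edge i z x) → Edge i z x
edge⇒Edge zero t = base t (λ ())
edge⇒Edge (suc i) t with T-∨ .to t
... | inj₁ kept = let (zx , ¬tri) = T-∧ .to kept in Edge-lift (edge⇒Edge i zx) (T-not⇔¬T .to ¬tri)
... | inj₂ new with T-∨ .to new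
...   | inj₁ tri   = triangle (top z<s) (triEdge⇒Corners tri)
...   | inj₂ cross with crossEdge⇒Corners cross
...     | inj₁ downward = triangle (down ≤-refl) downward
...     | inj₂ upward   = triangle (up ≤-refl) upward

-- An injective colouring of G⁴₀ giving the initial triangle (13, 1, 9) the colours 0, 1, 2.
baseColour : ℕ → Fin 8
baseColour 0  = # 7
baseColour 1  = # 1
baseColour 2  = # 4
baseColour 3  = # 2
baseColour 4  = # 3
baseColour 5  = # 7
baseColour 6  = # 5
baseColour 7  = # 4
baseColour 8  = # 1
baseColour 9  = # 2
baseColour 10 = # 0
baseColour 11 = # 3
baseColour 12 = # 6
baseColour 13 = # 0
baseColour 14 = # 6
baseColour _  = # 0

block : ℕ → Fin 2
block 0 = zero
block 1 = zero
block 2 = suc zero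
block 3 = suc zero
block (suc (suc (suc (suc k)))) = block k

parity : ℕ → ℕ
parity 0 = 0
parity 1 = 1
parity (suc (suc i)) = parity i

palette : ℕ → Fin 3 → Fin 8
palette k r = combine (block k) r ↑ˡ 2

-- The shift by parity i puts triangles i − 1 and i into different blocks while keeping
-- triangle 0 in block 0.
colour : ℕ → ℕ → Fin 8
colour i u with u <ᵇ 15
... | true  = baseColour u
... | false = let (q , r) = divMod3 (u ∸ 15) in palette (suc q + parity i) r

parity<2 : ∀ i → parity i < 2
parity<2 0 = z<s
parity<2 1 = s≤s z<s
parity<2 (suc (suc i)) = parity<2 i

block-parity : ∀ i → block (parity i) ≡ zero
block-parity 0 = refl
block-parity 1 = refl
block-parity (suc (suc i)) = block-parity i

block-+2 : ∀ k → block k ≢ block (2 + k)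
block-+2 0 ()
block-+2 1 ()
block-+2 2 ()
block-+2 3 ()
block-+2 (suc (suc (suc (suc k)))) = block-+2 k

block-top : ∀ j → block (j + parity (suc j)) ≢ block (suc j + parity (suc j))
block-top 0 ()
block-top 1 ()
block-top 2 ()
block-top 3 ()
block-top (suc (suc (suc (suc j)))) = block-top j

Linked-blocks : ∀ {i j k k'} → Linked i j k → Linked i j k' → k ≢ k' →
                block (k + parity i) ≢ block (k' + parity i)
Linked-blocks (up _)       (up _)       k≢k' = ⊥-elim (k≢k' refl)
Linked-blocks (up _)       (down {j} _) _    = ≢-sym (block-+2 (j + _))
Linked-blocks (up j<j)     (top _)      _    = ⊥-elim (<-irrefl refl j<j)
Linked-blocks (down {j} _) (up _)       _    = block-+2 (j + _)
Linked-blocks (down _)     (down _)     k≢k' = ⊥-elim (k≢k' refl)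
Linked-blocks (down {j} _) (top _)      _    = block-top j
Linked-blocks (top _)      (up j<j)     _    = ⊥-elim (<-irrefl refl j<j)
Linked-blocks (top _)      (down {j} _) _    = ≢-sym (block-top j)
Linked-blocks (top _)      (top _)      k≢k' = ⊥-elim (k≢k' refl)

palette-injective : ∀ k {r s} → palette k r ≡ palette k s → r ≡ s
palette-injective k {r} {s} eq = combine-injectiveʳ (block k) r (block k) s (↑ˡ-injective 2 _ _ eq)

palette-disjoint : ∀ k l {r s} → block k ≢ block l → palette k r ≢ palette l s
palette-disjoint k l {r} {s} blocks eq =
  blocks (combine-injectiveˡ (block k) r (block l) s (↑ˡ-injective 2 _ _ eq))

colour-base : ∀ i {x} → x < 15 → colour i x ≡ baseColour x
colour-base i {x} x<15 with x <ᵇ 15 | <⇒<ᵇ x<15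
... | true | _ = refl

colour-triVertex : ∀ i j r → colour i (triVertex j r) ≡ palette (j + parity i) r
colour-triVertex i zero r =
  trans (triangle₀ r) (cong (λ b → combine b r ↑ˡ 2) (sym (block-parity i)))
  where
  triangle₀ : ∀ r → colour i (triVertex 0 r) ≡ palette 0 r
  triangle₀ zero             = refl
  triangle₀ (suc zero)       = refl
  triangle₀ (suc (suc zero)) = refl
colour-triVertex i (suc j) r rewrite divMod3-correct j r = refl

baseColour-injective :
  ∀ {z} → z < 15 → ∀ {x} → x < 15 → ∀ {y} → y < 15 →
  T (edgeIn baseEdges z x) → T (edgeIn baseEdges z y) → x ≢ y → baseColour x ≢ baseColour y
baseColour-injective = toWitness {a? = allUpTo? (λ z → allUpTo? (λ x → allUpTo? (λ y →
  T? (edgeIn baseEdges z x) →-dec T? (edgeIn baseEdges z y) →-dec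
  ¬? (x ≟ y) →-dec ¬? (baseColour x FinP.≟ baseColour y)) 15) 15) 15} _

baseColour-avoids-triangle₁ :
  ∀ {x} → x < 15 → ∀ r s → r ≢ s → PersistentEdge (triVertex 0 r) x →
  ∀ {p} → p < 2 → baseColour x ≢ palette (1 + p) s
baseColour-avoids-triangle₁ = toWitness {a? = allUpTo? (λ x → FinP.all? λ r → FinP.all? λ s →
  ¬? (r FinP.≟ s) →-dec persistentEdge? (triVertex 0 r) x →-dec
  allUpTo? (λ p → ¬? (baseColour x FinP.≟ palette (1 + p) s)) 2) 15} _

colour-separates-base-triangle :
  ∀ {i j k z x y} → T (edgeIn baseEdges z x) → (0 < i → ¬ T (edgeIn (triEdges 0) z x)) →
  Linked i j k → Corners j k z y → colour i x ≢ colour i y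
colour-separates-base-triangle {i} {j} {z = z} {x} zx persists l (corners {r} {s} r≢s ez refl)
  with (z<15 , x<15) ← baseEdge-bounded z x zx
  with refl ← triVertex<15⇒j≡0 j r (subst (_< 15) ez z<15)
  with l
... | up 0<i = λ eq →
  baseColour-avoids-triangle₁ x<15 r s r≢s
    (subst (λ z → PersistentEdge z x) ez (zx , persists 0<i)) (parity<2 i)
    (trans (sym (colour-base i {x} x<15)) (trans eq (colour-triVertex i 1 s)))
... | top ()

colour-separates-triangles : ∀ {i j k k' s s'} → Linked i j k → Linked i j k' → (k , s) ≢ (k' , s') →
                        colour i (triVertex k s) ≢ colour i (triVertex k' s')
colour-separates-triangles {i} {k = k} {k'} {s} {s'} l l' ks≢k's'
  rewrite colour-triVertex i k s | colour-triVertex i k' s' with k ≟ k'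
... | yes refl = ks≢k's' ∘ cong (k ,_) ∘ palette-injective (k + parity i)
... | no k≢k'  = palette-disjoint (k + parity i) (k' + parity i) (Linked-blocks l l' k≢k')

colour-separates : ∀ {i z x y} → Edge i z x → Edge i z y → x ≢ y → colour i x ≢ colour i y
colour-separates {i} {z} {x} {y} (base zx _) (base zy _) x≢y eq
  with (z<15 , x<15) ← baseEdge-bounded z x zx | (_ , y<15) ← baseEdge-bounded z y zy =
  baseColour-injective z<15 x<15 y<15 zx zy x≢y
    (trans (sym (colour-base i {x} x<15)) (trans eq (colour-base i {y} y<15)))
colour-separates {x = x} {y} (base zx persists) (triangle l cs) _ =
  colour-separates-base-triangle {x = x} {y} zx persists l cs
colour-separates {x = x} {y} (triangle l cs) (base zy persists) _ =
  ≢-sym (colour-separates-base-triangle {x = y} {x} zy persists l cs)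
colour-separates (triangle {j} l (corners {r} _ ez refl)) (triangle {j'} l' (corners {r'} _ ez' refl)) x≢y
  with refl ← triVertex-injectiveˡ {j} {j'} {r} {r'} (trans (sym ez) ez') =
  colour-separates-triangles l l' (x≢y ∘ cong (uncurry triVertex))

injectiveColouring : ∀ i → HasInjectiveColouring (G4 i) 8
injectiveColouring i = colour i ∘ toℕ , λ x y z x≢y zx zy →
  colour-separates (edge⇒Edge i zx) (edge⇒Edge i zy) (x≢y ∘ toℕ-injective)

edge-lift : ∀ {i u v} → T (edge i u v) → ¬ T (edgeIn (triEdges i) u v) → T (edge (suc i) u v)
edge-lift t ¬tri = T-∨ .from (inj₁ (T-∧ .from (t , T-not⇔¬T .from ¬tri)))

triEdge⇒≮15 : ∀ {j u v} → T (edgeIn (triEdges (suc j)) u v) → v ≮ 15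
triEdge⇒≮15 {j} {u} {v} t v<15 with triEdge⇒Corners {suc j} {u} {v} t
... | corners {s = s} _ _ refl = triVertex≮15 j s v<15

edge₁-persists : ∀ i {u v} → v < 15 → T (edge 1 u v) → T (edge (suc i) u v)
edge₁-persists zero    _    t = t
edge₁-persists (suc i) {u} {v} v<15 t =
  edge-lift {suc i} {u} {v} (edge₁-persists i v<15 t) (λ tri → triEdge⇒≮15 {i} {u} {v} tri v<15)

persistentEdge⇒edge : ∀ i {u v} → PersistentEdge u v → T (edge i u v)
persistentEdge⇒edge zero            (uv , _)    = uv
persistentEdge⇒edge (suc i) {u} {v} (uv , ¬tri) =
  edge₁-persists i (proj₂ (baseEdge-bounded u v uv)) (edge-lift {0} {u} {v} uv ¬tri)

InTriangle₀ : ℕ → Set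
InTriangle₀ x = ∃ λ r → x ≡ triVertex 0 r

Conflict : ℕ → ℕ → Set
Conflict x y = (InTriangle₀ x × InTriangle₀ y)
             ⊎ ∃ λ w → w < 15 × PersistentEdge w x × PersistentEdge w y

-- Opaque because unfolding this decision procedure at its use site is very slow.
opaque
  noIndependentTriple :
    ∀ {x} → x < 15 → ∀ {y} → y < 15 → ∀ {z} → z < 15 → x ≢ y → y ≢ z → x ≢ z →
    Conflict x y ⊎ Conflict y z ⊎ Conflict x z
  noIndependentTriple = toWitness {a? = allUpTo? (λ x → allUpTo? (λ y → allUpTo? (λ z →
    ¬? (x ≟ y) →-dec ¬? (y ≟ z) →-dec ¬? (x ≟ z) →-dec
    (conflict? x y ⊎-dec conflict? y z ⊎-dec conflict? x z)) 15) 15) 15} _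
    where
    inTriangle₀? : ∀ x → Dec (InTriangle₀ x)
    inTriangle₀? x = FinP.any? λ r → x ≟ triVertex 0 r
    conflict? : ∀ x y → Dec (Conflict x y)
    conflict? x y = (inTriangle₀? x ×-dec inTriangle₀? y) ⊎-dec
                    anyUpTo? (λ w → persistentEdge? w x ×-dec persistentEdge? w y) 15

CommonNeighbour : ℕ → ℕ → ℕ → Set
CommonNeighbour i x y = ∃ λ w → w < 15 + 3 * i × T (edge i w x) × T (edge i w y)

commonNeighbour-triangle₀-G₀ : ∀ r s → r ≢ s → CommonNeighbour 0 (triVertex 0 r) (triVertex 0 s)
commonNeighbour-triangle₀-G₀ = toWitness {a? = FinP.all? λ r → FinP.all? λ s → ¬? (r FinP.≟ s) →-dec
  anyUpTo? (λ w → T? (edge 0 w (triVertex 0 r)) ×-dec T? (edge 0 w (triVertex 0 s))) 15} _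

commonNeighbour-triangle₀-G₁ : ∀ r s → r ≢ s → CommonNeighbour 1 (triVertex 0 r) (triVertex 0 s)
commonNeighbour-triangle₀-G₁ = toWitness {a? = FinP.all? λ r → FinP.all? λ s → ¬? (r FinP.≟ s) →-dec
  anyUpTo? (λ w → T? (edge 1 w (triVertex 0 r)) ×-dec T? (edge 1 w (triVertex 0 s))) 18} _

conflict⇒commonNeighbour : ∀ i {x y} → Conflict x y → x ≢ y → CommonNeighbour i x y
conflict⇒commonNeighbour i (inj₂ (w , w<15 , wx , wy)) _ =
  w , ≤-trans w<15 (m≤m+n 15 (3 * i)) , persistentEdge⇒edge i wx , persistentEdge⇒edge i wy
conflict⇒commonNeighbour zero (inj₁ ((r , refl) , (s , refl))) x≢y =
  commonNeighbour-triangle₀-G₀ r s (x≢y ∘ cong (triVertex 0))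
conflict⇒commonNeighbour (suc i) (inj₁ ((r , refl) , (s , refl))) x≢y
  with (w , w<18 , wx , wy) ← commonNeighbour-triangle₀-G₁ r s (x≢y ∘ cong (triVertex 0)) =
  w , ≤-trans w<18 (+-monoʳ-≤ 15 (*-monoʳ-≤ 3 (s≤s z≤n))) ,
  edge₁-persists i (triVertex₀<15 r) wx , edge₁-persists i (triVertex₀<15 s) wy

module _ {i k} {c : Fin (15 + 3 * i) → Fin k} (c-injective : IsInjectiveColouring (G4 i) k c) where

  commonNeighbour⇒distinctColours : ∀ {x y} → CommonNeighbour i (toℕ x) (toℕ y) → x ≢ y → c x ≢ c y
  commonNeighbour⇒distinctColours {x} {y} (w , w<n , wx , wy) x≢y =
    c-injective x y (fromℕ< w<n) x≢y (subst (λ m → T (edge i m (toℕ x))) (sym (toℕ-fromℕ< w<n)) wx)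
                                     (subst (λ m → T (edge i m (toℕ y))) (sym (toℕ-fromℕ< w<n)) wy)

  baseColouring : Fin 15 → Fin k
  baseColouring b = c (b ↑ˡ 3 * i)

  conflict⇒distinctColours : ∀ {a b} → Conflict (toℕ a) (toℕ b) → a ≢ b →
                             baseColouring a ≢ baseColouring b
  conflict⇒distinctColours {a} {b} conflict a≢b =
    commonNeighbour⇒distinctColours
      (subst₂ (CommonNeighbour i) (sym (toℕ-↑ˡ a _)) (sym (toℕ-↑ˡ b _))
        (conflict⇒commonNeighbour i conflict (a≢b ∘ toℕ-injective)))
      (a≢b ∘ ↑ˡ-injective _ a b)

  baseColouring-noMonochromaticTriple : NoMonochromaticTriple baseColouring
  baseColouring-noMonochromaticTriple {a} {b} {d} a≢b b≢d a≢d ca≡cb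
    with noIndependentTriple (toℕ<n a) (toℕ<n b) (toℕ<n d)
           (a≢b ∘ toℕ-injective) (b≢d ∘ toℕ-injective) (a≢d ∘ toℕ-injective)
  ... | inj₁ ab       = ⊥-elim (conflict⇒distinctColours ab a≢b ca≡cb)
  ... | inj₂ (inj₁ bd) = conflict⇒distinctColours bd b≢d
  ... | inj₂ (inj₂ ad) = conflict⇒distinctColours ad a≢d ∘ trans ca≡cb

  eight≤colours : 8 ≤ k
  eight≤colours =
    *-cancelʳ-< 2 7 k (noMonochromaticTriple⇒≤ baseColouring baseColouring-noMonochromaticTriple)

theorem7 : ∀ (i : ℕ) → InjChromaticNumber (G4 i) 8
theorem7 i = injectiveColouring i , λ _ (_ , c-injective) → eight≤colours {i} c-injective
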